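{- Let $A$ be the adjacency matrix of a doubly regular tournament on $n$ vertices, and let $A'=J-I-A$. Then the incidence structure $(\mathcal{V}_A,\mathcal{B}_A\cup\mathcal{B}_{A'})$ is a $2$-$(n,\frac{n-1}{2},\frac{n-3}{2})$ design and a $3$-$(n,\frac{n-1}{2},\frac{n-7}{4})$ adesign.
   Context: $J$ denotes the all-one matrix and $I$ the identity matrix. A tournament on $n$ vertices is a directed graph in which every pair of distinct vertices is joined by exactly one arc; its adjacency matrix $A$ has $(A)_{xy}=1$ iff there is an arc $xy$. It is doubly regular if every vertex has in-degree and out-degree $\frac{n-1}{2}$, and every pair of distinct vertices has exactly $\frac{n-3}{4}$ common out-neighbours and the same number of common in-neighbours. For a $0$-$1$ matrix $M$ with rows and columns indexed by the vertex set, $\mathcal{V}_M$ denotes the set indexing the columns and $\mathcal{B}_M$ the collection of supports of the rows of $M$ (one block per row); the union is the collection of all these $2n$ blocks. A $t$-$(v,k,\lambda)$ design has $v$ points, all blocks of size $k$, and every $t$-subset of points in exactly $\lambda$ blocks. A $t$-$(v,k,\lambda)$ adesign has $v$ points, all blocks of size $k$, every $t$-subset in either $\lambda$ or $\lambda+1$ blocks for a positive integer $\lambda$, and is not a $t$-design. -}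

module Defs where

open import Data.Nat using (ℕ; suc; _<_; _+_; _*_)
open import Data.Bool using (Bool; true; false; not; _∧_)
open import Data.Fin using (Fin)
open import Data.Fin.Subset using (Subset; _⊆_; _∩_; ∣_∣)
open import Data.Fin.Subset.Properties using (_⊆?_)
open import Data.Vec using (tabulate)
open import Data.List using (List; length; filter; map; _++_; allFin)
open import Data.List.Relation.Unary.All using (All)
open import Data.Fin.Properties using () renaming (_≟_ to _≟F_)
open import Relation.Nullary using (¬_; does)
open import Relation.Binary.PropositionalEquality using (_≡_; _≢_)
open import Data.Product using (_×_; ∃)
open import Data.Sum using (_⊎_)

Matrix01 : ℕ → Set
Matrix01 n = Fin n → Fin n → Bool

-- A' = J - I - A : entry (x,y) is 1 iff x ≠ y and A x y = 0.
complementTournament : ∀ {n} → Matrix01 n → Matrix01 n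
complementTournament A x y = not (A x y) ∧ not (does (x ≟F y))

rowSupport : ∀ {n} → Matrix01 n → Fin n → Subset n
rowSupport M x = tabulate (λ y → M x y)

colSupport : ∀ {n} → Matrix01 n → Fin n → Subset n
colSupport M y = tabulate (λ x → M x y)

-- the block collection B_M (one block per row, as a list = multiset)
blocks : ∀ {n} → Matrix01 n → List (Subset n)
blocks {n} M = map (rowSupport M) (allFin n)

IsTournament : ∀ {n} → Matrix01 n → Set
IsTournament {n} A =
  (∀ x → A x x ≡ false) ×
  (∀ x y → x ≢ y → (A x y ≡ true × A y x ≡ false) ⊎ (A x y ≡ false × A y x ≡ true))

-- doubly regular: in/out-degrees (n-1)/2, common out-/in-neighbours (n-3)/4
-- (the equalities are stated multiplied out, so they hold in ℕ exactly)
IsDoublyRegularTournament : ∀ {n} → Matrix01 n → Set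
IsDoublyRegularTournament {n} A =
  IsTournament A ×
  (∀ x → 2 * ∣ rowSupport A x ∣ + 1 ≡ n) ×
  (∀ x → 2 * ∣ colSupport A x ∣ + 1 ≡ n) ×
  (∀ x y → x ≢ y → 4 * ∣ rowSupport A x ∩ rowSupport A y ∣ + 3 ≡ n) ×
  (∀ x y → x ≢ y → 4 * ∣ colSupport A x ∩ colSupport A y ∣ + 3 ≡ n)

occurrences : ∀ {v} → Subset v → List (Subset v) → ℕ
occurrences T B = length (filter (T ⊆?_) B)

IsDesign : (t v k lam : ℕ) → List (Subset v) → Set
IsDesign t v k lam B =
  All (λ b → ∣ b ∣ ≡ k) B ×
  (∀ (T : Subset v) → ∣ T ∣ ≡ t → occurrences T B ≡ lam)

IsADesign : (t v k lam : ℕ) → List (Subset v) → Set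
IsADesign t v k lam B =
  0 < lam ×
  All (λ b → ∣ b ∣ ≡ k) B ×
  (∀ (T : Subset v) → ∣ T ∣ ≡ t →
     occurrences T B ≡ lam ⊎ occurrences T B ≡ suc lam) ×
  ¬ (∃ λ μ → IsDesign t v k μ B)

-- Write n = 4k + 3. The blocks are the out-neighbourhoods (rows of A) and in-neighbourhoods
-- (rows of A') of the vertices, all of size 2k + 1, and a set lies in the block of x iff x
-- dominates, resp. is dominated by, all of it. A pair therefore lies in (common in-neighbours)
-- + (common out-neighbours) = 2k blocks. For a triple {a, b, c} lying in N blocks, count the
-- pairs (x, {u, v}) with {u, v} ⊆ {a, b, c} inside a block of x: the pair count gives 3 · 2k.
-- A vertex x outside the triple sees a, b, c as three Booleans and contributes
-- 1 + 2·[all three agree], for 4k + 2N in total; a vertex of the triple contributes 1 iff it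
-- dominates or is dominated by both others, which happens for 2 vertices of a transitive and
-- for none of a cyclic triple. Hence N = k - 1 on transitive and N = k on cyclic triples, and
-- both kinds occur, so the structure is a 3-adesign but no 3-design.
module Submission where

open import Defs
open import Data.Nat using (ℕ; zero; suc; _+_; _*_; _∸_; _/_; _<_; s≤s; z≤n)
open import Data.Nat.Properties
  using (+-*-semiring; +-comm; +-identityʳ; *-identityʳ; *-suc; *-cancelˡ-≡; +-cancelˡ-≡;
         suc-injective; m+n∸m≡n; 1+n≢n)
open import Data.Nat.DivMod using (m*n/n≡m)
open import Data.Nat.Tactic.RingSolver using (solve-∀)
import Data.Nat.ListAction as Nat
open import Data.Bool using (Bool; true; false; not; _∧_; T)
open import Data.Bool.Properties using (T-≡; ∧-zeroʳ; ∧-identityʳ; not-injective)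
open import Data.Bool.ListAction using (all)
open import Data.Fin using (Fin; zero; suc)
open import Data.Fin.Properties using (_≟_)
import Data.Fin.Properties as Fin
open import Data.Fin.Subset using (Subset; inside; outside; _∈_; _∉_; _⊆_; _∩_; _∪_; _-_; ⁅_⁆; ⊥; ∣_∣; Nonempty)
open import Data.Fin.Subset.Properties
  using (_⊆?_; nonempty?; Empty-unique; ∣⊥∣≡0; ∉⊥; x∈⁅x⁆; x∈⁅y⁆⇒x≡y; x∈p∪q⁺; x∈p∪q⁻; ∪-identityˡ;
         p─⊥≡p; p─q⊆p; x∈p∧x≢y⇒x∈p-y; ⊆-antisym)
open import Data.Vec as Vec using ([]; _∷_; here; there)
open import Data.Vec.Properties using (lookup∘tabulate; []=⇒lookup; lookup⇒[]=; tabulate-cong)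
open import Data.List as List using (List; []; _∷_; _++_; length; filter; foldr; allFin)
open import Data.List.Properties using (length-++; filter-++; map-tabulate)
open import Data.List.Membership.Propositional using () renaming (_∈_ to _∈ₗ_)
open import Data.List.Relation.Unary.Any using (here; there; any?)
open import Data.List.Relation.Unary.All as All using (All; []; _∷_)
open import Data.List.Relation.Unary.All.Properties using (all⁺; all⁻; ¬Any⇒All¬; All¬⇒¬Any; ++⁺; map⁺)
open import Data.List.Relation.Unary.AllPairs using ([]; _∷_)
open import Data.List.Relation.Unary.Unique.Propositional using (Unique)
open import Data.Product using (_×_; _,_; proj₁; proj₂; ∃-syntax)
open import Data.Sum as Sum using (_⊎_; inj₁; inj₂)
open import Function using (_∘_; _⇔_; mk⇔; Equivalence)
open import Relation.Nullary using (Dec; yes; no; does; ¬_; contradiction)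
open import Relation.Nullary.Decidable using (does-⇔; T?; dec-true; dec-false)
open import Relation.Unary using (Decidable)
open import Relation.Binary.PropositionalEquality
open import Algebra.Properties.Semiring.Sum +-*-semiring
  using (sum; sum-cong-≗; ∑-distrib-+; sum-replicate-zero; *-distribˡ-sum)

private
  variable
    n : ℕ

indicator : Bool → ℕ
indicator true  = 1
indicator false = 0

count : (Fin n → Bool) → ℕ
count p = sum (indicator ∘ p)

count-true : count {n} (λ _ → true) ≡ n
count-true {zero}  = refl
count-true {suc n} = cong suc count-true

count-∧-split : (p q : Fin n → Bool) → count p ≡ count (λ x → p x ∧ q x) + count (λ x → p x ∧ not (q x))
count-∧-split p q =
  trans (sum-cong-≗ λ x → split (p x) (q x))
        (∑-distrib-+ (λ x → indicator (p x ∧ q x)) (λ x → indicator (p x ∧ not (q x))))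
  where
  split : ∀ b c → indicator b ≡ indicator (b ∧ c) + indicator (b ∧ not c)
  split true  true  = refl
  split true  false = refl
  split false _     = refl

∑-sift : (a : Fin n) (f : Fin n → ℕ) → sum (λ x → indicator (does (x ≟ a)) * f x) ≡ f a
∑-sift {suc n} zero    f = trans (cong₂ _+_ (+-identityʳ (f zero)) (sum-replicate-zero n)) (+-identityʳ (f zero))
∑-sift {suc n} (suc a) f = ∑-sift a (f ∘ suc)

_∈?_ : (x : Fin n) (ps : List (Fin n)) → Dec (x ∈ₗ ps)
x ∈? ps = any? (x ≟_) ps

∑-sift-list : (f : Fin n → ℕ) {ps : List (Fin n)} → Unique ps →
  sum (λ x → indicator (does (x ∈? ps)) * f x) ≡ Nat.sum (List.map f ps)
∑-sift-list {n} f []                     = sum-replicate-zero n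
∑-sift-list     f {p ∷ ps} (p∉ps ∷ uniq) = begin
  sum (λ x → indicator (does (x ∈? (p ∷ ps))) * f x)
    ≡⟨ sum-cong-≗ split ⟩
  sum (λ x → indicator (does (x ≟ p)) * f x + indicator (does (x ∈? ps)) * f x)
    ≡⟨ ∑-distrib-+ (λ x → indicator (does (x ≟ p)) * f x) (λ x → indicator (does (x ∈? ps)) * f x) ⟩
  sum (λ x → indicator (does (x ≟ p)) * f x) + sum (λ x → indicator (does (x ∈? ps)) * f x)
    ≡⟨ cong₂ _+_ (∑-sift p f) (∑-sift-list f uniq) ⟩
  f p + Nat.sum (List.map f ps) ∎
  where
  open ≡-Reasoning
  split : ∀ x → indicator (does (x ∈? (p ∷ ps))) * f x
                ≡ indicator (does (x ≟ p)) * f x + indicator (does (x ∈? ps)) * f x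
  split x with x ≟ p
  ... | yes refl rewrite dec-false (x ∈? ps) (All¬⇒¬Any p∉ps) = sym (+-identityʳ (f x + 0))
  ... | no  _    = refl

∣tabulate∣≡count : (p : Fin n → Bool) → ∣ Vec.tabulate p ∣ ≡ count p
∣tabulate∣≡count {zero}  p = refl
∣tabulate∣≡count {suc n} p with p zero
... | true  = cong suc (∣tabulate∣≡count (p ∘ suc))
... | false = ∣tabulate∣≡count (p ∘ suc)

∣tabulate∩tabulate∣≡count : (p q : Fin n → Bool) → ∣ Vec.tabulate p ∩ Vec.tabulate q ∣ ≡ count (λ x → p x ∧ q x)
∣tabulate∩tabulate∣≡count {zero}  p q = refl
∣tabulate∩tabulate∣≡count {suc n} p q with p zero ∧ q zero
... | true  = cong suc (∣tabulate∩tabulate∣≡count (p ∘ suc) (q ∘ suc))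
... | false = ∣tabulate∩tabulate∣≡count (p ∘ suc) (q ∘ suc)

∈-tabulate⇔ : {x : Fin n} {p : Fin n → Bool} → x ∈ Vec.tabulate p ⇔ T (p x)
∈-tabulate⇔ {x = x} {p} = mk⇔
  (λ x∈ → Equivalence.from T-≡ (trans (sym (lookup∘tabulate p x)) ([]=⇒lookup x∈)))
  (λ px → lookup⇒[]= x _ (trans (lookup∘tabulate p x) (Equivalence.to T-≡ px)))

∣p∣≡1+k⇒Nonempty : {p : Subset n} {k : ℕ} → ∣ p ∣ ≡ suc k → Nonempty p
∣p∣≡1+k⇒Nonempty {n} {p} ∣p∣≡1+k with nonempty? p
... | yes ne = ne
... | no ¬ne = contradiction (trans (sym ∣p∣≡1+k) (trans (cong ∣_∣ (Empty-unique ¬ne)) (∣⊥∣≡0 n))) λ ()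

count≡1+m⇒∃ : {p : Fin n → Bool} {m : ℕ} → count p ≡ suc m → ∃[ x ] p x ≡ true
count≡1+m⇒∃ {p = p} count≡1+m with ∣p∣≡1+k⇒Nonempty (trans (∣tabulate∣≡count p) count≡1+m)
... | x , x∈p = x , Equivalence.to T-≡ (Equivalence.to ∈-tabulate⇔ x∈p)

∧≡true⇒ : ∀ {x y} → x ∧ y ≡ true → x ≡ true × y ≡ true
∧≡true⇒ {true} {true} _ = refl , refl

-- Finite subsets given by lists of their points

fromList : List (Fin n) → Subset n
fromList = foldr (λ x p → ⁅ x ⁆ ∪ p) ⊥

∈-fromList⁻ : {x : Fin n} (ps : List (Fin n)) → x ∈ fromList ps → x ∈ₗ ps
∈-fromList⁻ []       x∈ = contradiction x∈ ∉⊥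
∈-fromList⁻ (y ∷ ps) x∈ with x∈p∪q⁻ ⁅ y ⁆ (fromList ps) x∈
... | inj₁ x∈⁅y⁆ = here (x∈⁅y⁆⇒x≡y y x∈⁅y⁆)
... | inj₂ x∈ps  = there (∈-fromList⁻ ps x∈ps)

∈-fromList⁺ : {x : Fin n} {ps : List (Fin n)} → x ∈ₗ ps → x ∈ fromList ps
∈-fromList⁺ (here refl) = x∈p∪q⁺ (inj₁ (x∈⁅x⁆ _))
∈-fromList⁺ (there x∈)  = x∈p∪q⁺ (inj₂ (∈-fromList⁺ x∈))

∣⁅x⁆∪p∣≡1+∣p∣ : {x : Fin n} {p : Subset n} → x ∉ p → ∣ ⁅ x ⁆ ∪ p ∣ ≡ suc ∣ p ∣
∣⁅x⁆∪p∣≡1+∣p∣ {x = zero}  {outside ∷ p} x∉p = cong (suc ∘ ∣_∣) (∪-identityˡ p)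
∣⁅x⁆∪p∣≡1+∣p∣ {x = zero}  {inside  ∷ p} x∉p = contradiction here x∉p
∣⁅x⁆∪p∣≡1+∣p∣ {x = suc x} {outside ∷ p} x∉p = ∣⁅x⁆∪p∣≡1+∣p∣ (x∉p ∘ there)
∣⁅x⁆∪p∣≡1+∣p∣ {x = suc x} {inside  ∷ p} x∉p = cong suc (∣⁅x⁆∪p∣≡1+∣p∣ (x∉p ∘ there))

∣fromList∣≡length : {ps : List (Fin n)} → Unique ps → ∣ fromList ps ∣ ≡ length ps
∣fromList∣≡length {n} {[]}      []            = ∣⊥∣≡0 n
∣fromList∣≡length {ps = x ∷ ps} (x∉ps ∷ uniq) =
  trans (∣⁅x⁆∪p∣≡1+∣p∣ (All¬⇒¬Any x∉ps ∘ ∈-fromList⁻ ps)) (cong suc (∣fromList∣≡length uniq))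

∣p∣≡0⇒p≡⊥ : {p : Subset n} → ∣ p ∣ ≡ 0 → p ≡ ⊥
∣p∣≡0⇒p≡⊥ {p = []}          _     = refl
∣p∣≡0⇒p≡⊥ {p = outside ∷ p} ∣p∣≡0 = cong (outside ∷_) (∣p∣≡0⇒p≡⊥ ∣p∣≡0)

x∈p-y⇒x≢y : {p : Subset n} {x y : Fin n} → x ∈ p - y → x ≢ y
x∈p-y⇒x≢y {p = inside  ∷ p} {zero}  {zero}  ()
x∈p-y⇒x≢y {p = outside ∷ p} {zero}  {zero}  ()
x∈p-y⇒x≢y {p = _ ∷ p}       {zero}  {suc y} _          ()
x∈p-y⇒x≢y {p = _ ∷ p}       {suc x} {zero}  _          ()
x∈p-y⇒x≢y {p = _ ∷ p}       {suc x} {suc y} (there x∈) = x∈p-y⇒x≢y x∈ ∘ Fin.suc-injective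

x∈p⇒∣p∣≡1+∣p-x∣ : {p : Subset n} {x : Fin n} → x ∈ p → ∣ p ∣ ≡ suc ∣ p - x ∣
x∈p⇒∣p∣≡1+∣p-x∣ {p = inside  ∷ p} here        = cong (suc ∘ ∣_∣) (sym (p─⊥≡p p))
x∈p⇒∣p∣≡1+∣p-x∣ {p = inside  ∷ p} (there x∈p) = cong suc (x∈p⇒∣p∣≡1+∣p-x∣ x∈p)
x∈p⇒∣p∣≡1+∣p-x∣ {p = outside ∷ p} (there x∈p) = x∈p⇒∣p∣≡1+∣p-x∣ x∈p

x∈p⇒p≡⁅x⁆∪p-x : {p : Subset n} {x : Fin n} → x ∈ p → p ≡ ⁅ x ⁆ ∪ (p - x)
x∈p⇒p≡⁅x⁆∪p-x {p = p} {x} x∈p = ⊆-antisym p⊆⁅x⁆∪p-x ⁅x⁆∪p-x⊆p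
  where
  p⊆⁅x⁆∪p-x : p ⊆ ⁅ x ⁆ ∪ (p - x)
  p⊆⁅x⁆∪p-x {y} y∈p with y ≟ x
  ... | yes refl = x∈p∪q⁺ (inj₁ (x∈⁅x⁆ y))
  ... | no  y≢x  = x∈p∪q⁺ (inj₂ (x∈p∧x≢y⇒x∈p-y y∈p y≢x))
  ⁅x⁆∪p-x⊆p : ⁅ x ⁆ ∪ (p - x) ⊆ p
  ⁅x⁆∪p-x⊆p {y} y∈ with x∈p∪q⁻ ⁅ x ⁆ (p - x) y∈
  ... | inj₁ y∈⁅x⁆ = subst (_∈ p) (sym (x∈⁅y⁆⇒x≡y x y∈⁅x⁆)) x∈p
  ... | inj₂ y∈p-x = p─q⊆p p ⁅ x ⁆ y∈p-x

enumerate : (k : ℕ) (p : Subset n) → ∣ p ∣ ≡ k → ∃[ ps ] Unique ps × length ps ≡ k × p ≡ fromList ps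
enumerate zero    p ∣p∣≡0 = [] , [] , refl , ∣p∣≡0⇒p≡⊥ ∣p∣≡0
enumerate (suc k) p ∣p∣≡1+k with ∣p∣≡1+k⇒Nonempty ∣p∣≡1+k
... | x , x∈p with enumerate k (p - x) (suc-injective (trans (sym (x∈p⇒∣p∣≡1+∣p-x∣ x∈p)) ∣p∣≡1+k))
... | ps , uniq , length≡k , p-x≡ps =
  x ∷ ps , ¬Any⇒All¬ ps x∉ps ∷ uniq , cong suc length≡k , trans (x∈p⇒p≡⁅x⁆∪p-x x∈p) (cong (⁅ x ⁆ ∪_) p-x≡ps)
  where
  x∉ps : ¬ x ∈ₗ ps
  x∉ps x∈ps = x∈p-y⇒x≢y (subst (x ∈_) (sym p-x≡ps) (∈-fromList⁺ x∈ps)) refl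

two-elements : {p : Subset n} → ∣ p ∣ ≡ 2 → ∃[ a ] ∃[ b ] a ≢ b × p ≡ fromList (a ∷ b ∷ [])
two-elements {p = p} ∣p∣≡2 with enumerate 2 p ∣p∣≡2
... | a ∷ b ∷ []    , (a≢b ∷ []) ∷ [] ∷ [] , _ , p≡ab = a , b , a≢b , p≡ab
... | []            , _ , () , _
... | _ ∷ []        , _ , () , _
... | _ ∷ _ ∷ _ ∷ _ , _ , () , _

three-elements : {p : Subset n} → ∣ p ∣ ≡ 3 →
  ∃[ a ] ∃[ b ] ∃[ c ] a ≢ b × a ≢ c × b ≢ c × p ≡ fromList (a ∷ b ∷ c ∷ [])
three-elements {p = p} ∣p∣≡3 with enumerate 3 p ∣p∣≡3
... | a ∷ b ∷ c ∷ []    , (a≢b ∷ a≢c ∷ []) ∷ (b≢c ∷ []) ∷ [] ∷ [] , _ , p≡abc = a , b , c , a≢b , a≢c , b≢c , p≡abc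
... | []                , _ , () , _
... | _ ∷ []            , _ , () , _
... | _ ∷ _ ∷ []        , _ , () , _
... | _ ∷ _ ∷ _ ∷ _ ∷ _ , _ , () , _

fromList⊆⇔ : {ps : List (Fin n)} {q : Subset n} → fromList ps ⊆ q ⇔ All (_∈ q) ps
fromList⊆⇔ {ps = ps} {q} = mk⇔ to from
  where
  to : fromList ps ⊆ q → All (_∈ q) ps
  to ps⊆q = All.tabulate (ps⊆q ∘ ∈-fromList⁺)
  from : All (_∈ q) ps → fromList ps ⊆ q
  from ps∈q = All.lookup ps∈q ∘ ∈-fromList⁻ ps

does-fromList⊆?tabulate : (ps : List (Fin n)) (h : Fin n → Bool) → does (fromList ps ⊆? Vec.tabulate h) ≡ all h ps
does-fromList⊆?tabulate ps h = does-⇔ ⊆⇔all (fromList ps ⊆? Vec.tabulate h) (T? (all h ps))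
  where
  ⊆⇔all : fromList ps ⊆ Vec.tabulate h ⇔ T (all h ps)
  ⊆⇔all = mk⇔ to from
    where
    to : fromList ps ⊆ Vec.tabulate h → T (all h ps)
    to ps⊆ = all⁻ h (All.map (Equivalence.to ∈-tabulate⇔) (Equivalence.to (fromList⊆⇔ {ps = ps}) ps⊆))
    from : T (all h ps) → fromList ps ⊆ Vec.tabulate h
    from all-h = Equivalence.from (fromList⊆⇔ {ps = ps}) (All.map (Equivalence.from ∈-tabulate⇔) (all⁺ h ps all-h))

all-cong : ∀ {A : Set} {p q : A → Bool} {xs : List A} → All (λ x → p x ≡ q x) xs → all p xs ≡ all q xs
all-cong []            = refl
all-cong (px≡qx ∷ p≡q) = cong₂ _∧_ px≡qx (all-cong p≡q)

all-false : ∀ {A : Set} {p : A → Bool} {x : A} {xs : List A} → x ∈ₗ xs → p x ≡ false → all p xs ≡ false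
all-false {p = p} {xs = _ ∷ xs} (here refl)          px≡false = cong (_∧ all p xs) px≡false
all-false {p = p}               (there {x = y} x∈xs) px≡false =
  trans (cong (p y ∧_) (all-false x∈xs px≡false)) (∧-zeroʳ (p y))

agreeing-pairs : ∀ {X : Set} (f : X → Bool) (a b c : X) →
  let agree ps = indicator (all f ps) + indicator (all (not ∘ f) ps) in
  agree (a ∷ b ∷ []) + agree (a ∷ c ∷ []) + agree (b ∷ c ∷ []) ≡ suc (2 * agree (a ∷ b ∷ c ∷ []))
agreeing-pairs f a b c with f a | f b | f c
... | true  | true  | true  = refl
... | true  | true  | false = refl
... | true  | false | true  = refl
... | true  | false | false = refl
... | false | true  | true  = refl
... | false | true  | false = refl
... | false | false | true  = refl
... | false | false | false = refl

length-filter-tabulate : {A : Set} {P : A → Set} (P? : Decidable P) (g : Fin n → A) →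
  length (filter P? (List.tabulate g)) ≡ count (λ x → does (P? (g x)))
length-filter-tabulate {zero}  P? g = refl
length-filter-tabulate {suc n} P? g with does (P? (g zero))
... | true  = cong suc (length-filter-tabulate P? (g ∘ suc))
... | false = length-filter-tabulate P? (g ∘ suc)

occurrences-blocks++ : (ps : List (Fin n)) (M N : Matrix01 n) →
  occurrences (fromList ps) (blocks M ++ blocks N) ≡ count (λ x → all (M x) ps) + count (λ x → all (N x) ps)
occurrences-blocks++ {n} ps M N = begin
  length (filter (S ⊆?_) (blocks M ++ blocks N))
    ≡⟨ cong length (filter-++ (S ⊆?_) (blocks M) (blocks N)) ⟩
  length (filter (S ⊆?_) (blocks M) ++ filter (S ⊆?_) (blocks N))
    ≡⟨ length-++ (filter (S ⊆?_) (blocks M)) ⟩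
  occurrences S (blocks M) + occurrences S (blocks N)
    ≡⟨ cong₂ _+_ (occurrences-blocks M) (occurrences-blocks N) ⟩
  count (λ x → all (M x) ps) + count (λ x → all (N x) ps) ∎
  where
  open ≡-Reasoning
  S : Subset n
  S = fromList ps
  occurrences-blocks : (M : Matrix01 n) → occurrences S (blocks M) ≡ count (λ x → all (M x) ps)
  occurrences-blocks M = begin
    length (filter (S ⊆?_) (List.map (rowSupport M) (allFin n)))
      ≡⟨ cong (length ∘ filter (S ⊆?_)) (map-tabulate (λ x → x) (rowSupport M)) ⟩
    length (filter (S ⊆?_) (List.tabulate (rowSupport M)))
      ≡⟨ length-filter-tabulate (S ⊆?_) (rowSupport M) ⟩
    count (λ x → does (S ⊆? rowSupport M x))
      ≡⟨ sum-cong-≗ (λ x → cong indicator (does-fromList⊆?tabulate ps (M x))) ⟩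
    count (λ x → all (M x) ps) ∎

-- Tournaments

module Tournament {A : Matrix01 n} (tournament : IsTournament A) where

  loopless : ∀ x → A x x ≡ false
  loopless = proj₁ tournament

  antisymmetric : ∀ {x y} → x ≢ y → A y x ≡ not (A x y)
  antisymmetric {x} {y} x≢y with proj₂ tournament x y x≢y
  ... | inj₁ (Axy , Ayx) = trans Ayx (cong not (sym Axy))
  ... | inj₂ (Axy , Ayx) = trans Ayx (cong not (sym Axy))

  arc⇒≢ : ∀ {x y} → A x y ≡ true → x ≢ y
  arc⇒≢ {x} x→y refl = contradiction (trans (sym x→y) (loopless x)) λ ()

  converse-arc : ∀ {x y} → x ≢ y → A y x ≡ true → A x y ≡ false
  converse-arc x≢y y→x = not-injective (trans (sym (antisymmetric x≢y)) y→x)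

  complement≡transpose : ∀ x y → complementTournament A x y ≡ A y x
  complement≡transpose x y with x ≟ y
  ... | yes refl = trans (∧-zeroʳ (not (A x x))) (sym (loopless x))
  ... | no  x≢y  = trans (∧-identityʳ (not (A x y))) (sym (antisymmetric x≢y))

  hits : List (Fin n) → Fin n → ℕ
  hits ps x = indicator (all (A x) ps) + indicator (all (λ y → A y x) ps)

  occurrences≡∑hits : ∀ ps → occurrences (fromList ps) (blocks A ++ blocks (complementTournament A)) ≡ sum (hits ps)
  occurrences≡∑hits ps = begin
    occurrences (fromList ps) (blocks A ++ blocks (complementTournament A))
      ≡⟨ occurrences-blocks++ ps A (complementTournament A) ⟩
    count (λ x → all (A x) ps) + count (λ x → all (complementTournament A x) ps)
      ≡⟨ cong (count (λ x → all (A x) ps) +_)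
              (sum-cong-≗ λ x → cong indicator (all-cong (All.universal (complement≡transpose x) ps))) ⟩
    count (λ x → all (A x) ps) + count (λ x → all (λ y → A y x) ps)
      ≡⟨ ∑-distrib-+ (λ x → indicator (all (A x) ps)) (λ x → indicator (all (λ y → A y x) ps)) ⟨
    sum (hits ps) ∎
    where open ≡-Reasoning

  hits-member : ∀ {ps x} → x ∈ₗ ps → hits ps x ≡ 0
  hits-member {x = x} x∈ps =
    cong₂ _+_ (cong indicator (all-false x∈ps (loopless x))) (cong indicator (all-false x∈ps (loopless x)))

  hits-outside : ∀ {ps x} → All (x ≢_) ps → hits ps x ≡ indicator (all (A x) ps) + indicator (all (not ∘ A x) ps)
  hits-outside {ps} {x} x∉ps =
    cong (λ b → indicator (all (A x) ps) + indicator b) (all-cong (All.map antisymmetric x∉ps))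

  module Triple {a b c : Fin n} (a≢b : a ≢ b) (a≢c : a ≢ c) (b≢c : b ≢ c) where

    triple : List (Fin n)
    triple = a ∷ b ∷ c ∷ []

    triple-unique : Unique triple
    triple-unique = (a≢b ∷ a≢c ∷ []) ∷ (b≢c ∷ []) ∷ [] ∷ []

    member : Fin n → ℕ
    member x = indicator (does (x ∈? triple))

    pairHits : Fin n → ℕ
    pairHits x = hits (a ∷ b ∷ []) x + hits (a ∷ c ∷ []) x + hits (b ∷ c ∷ []) x

    pairHits-pointwise : ∀ x → pairHits x + member x ≡ 1 + (2 * hits triple x + member x * pairHits x)
    -- x ∈? triple unfolds on the concrete list, so the with cannot abstract it in the goal;
    -- dec-true / dec-false rewrite the membership test instead.
    pairHits-pointwise x with x ∈? triple
    ... | yes x∈T rewrite dec-true (x ∈? triple) x∈T | hits-member x∈T =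
      trans (+-comm (pairHits x) 1) (cong suc (sym (+-identityʳ (pairHits x))))
    ... | no  x∉T with ¬Any⇒All¬ triple x∉T
    ... | x≢a ∷ x≢b ∷ x≢c ∷ [] rewrite dec-false (x ∈? triple) x∉T = begin
      pairHits x + 0
        ≡⟨ +-identityʳ (pairHits x) ⟩
      pairHits x
        ≡⟨ cong₂ _+_ (cong₂ _+_ (hits-outside (x≢a ∷ x≢b ∷ [])) (hits-outside (x≢a ∷ x≢c ∷ [])))
                     (hits-outside (x≢b ∷ x≢c ∷ [])) ⟩
      agree (a ∷ b ∷ []) + agree (a ∷ c ∷ []) + agree (b ∷ c ∷ [])
        ≡⟨ agreeing-pairs (A x) a b c ⟩
      1 + 2 * agree triple
        ≡⟨ cong (λ h → 1 + (2 * h)) (sym (hits-outside (x≢a ∷ x≢b ∷ x≢c ∷ []))) ⟩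
      1 + 2 * hits triple x
        ≡⟨ cong suc (sym (+-identityʳ _)) ⟩
      1 + (2 * hits triple x + 0) ∎
      where
      open ≡-Reasoning
      agree : List (Fin n) → ℕ
      agree ps = indicator (all (A x) ps) + indicator (all (not ∘ A x) ps)

    -- At a vertex of the triple only the pair of the two others can be hit, namely when the
    -- vertex dominates, or is dominated by, both of them.
    apexes : ℕ
    apexes = Nat.sum (List.map pairHits triple)

    double-counting : sum pairHits + 3 ≡ n + (2 * sum (hits triple) + apexes)
    double-counting = begin
      sum pairHits + 3
        ≡⟨ cong (sum pairHits +_) member-total ⟨
      sum pairHits + sum member
        ≡⟨ ∑-distrib-+ pairHits member ⟨
      sum (λ x → pairHits x + member x)
        ≡⟨ sum-cong-≗ pairHits-pointwise ⟩
      sum (λ x → 1 + rest x)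
        ≡⟨ ∑-distrib-+ (λ _ → 1) rest ⟩
      count {n} (λ _ → true) + sum rest
        ≡⟨ cong (_+ sum rest) count-true ⟩
      n + sum rest
        ≡⟨ cong (n +_) (∑-distrib-+ (λ x → 2 * hits triple x) (λ x → member x * pairHits x)) ⟩
      n + (sum (λ x → 2 * hits triple x) + sum (λ x → member x * pairHits x))
        ≡⟨ cong (n +_) (cong₂ _+_ (sym (*-distribˡ-sum 2 (hits triple))) (∑-sift-list pairHits triple-unique)) ⟩
      n + (2 * sum (hits triple) + apexes) ∎
      where
      open ≡-Reasoning
      rest : Fin n → ℕ
      rest x = 2 * hits triple x + member x * pairHits x
      member-total : sum member ≡ 3
      member-total = trans (sum-cong-≗ λ x → sym (*-identityʳ (member x))) (∑-sift-list (λ _ → 1) triple-unique)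

    apexes-0-or-2 : apexes ≡ 0 ⊎ apexes ≡ 2
    apexes-0-or-2 rewrite loopless a | loopless b | loopless c
                        | antisymmetric a≢b | antisymmetric a≢c | antisymmetric b≢c
                        with A a b | A a c | A b c
    ... | true  | true  | true  = inj₂ refl
    ... | true  | true  | false = inj₂ refl
    ... | true  | false | true  = inj₁ refl
    ... | true  | false | false = inj₂ refl
    ... | false | true  | true  = inj₂ refl
    ... | false | true  | false = inj₁ refl
    ... | false | false | true  = inj₂ refl
    ... | false | false | false = inj₂ refl

    apexes-transitive : A a b ≡ true → A a c ≡ true → apexes ≡ 2
    apexes-transitive a→b a→c rewrite loopless a | loopless b | loopless c
                                    | antisymmetric a≢b | antisymmetric a≢c | antisymmetric b≢c
                                    | a→b | a→c with A b c
    ... | true  = refl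
    ... | false = refl

    apexes-cyclic : A a b ≡ true → A b c ≡ true → A c a ≡ true → apexes ≡ 0
    apexes-cyclic a→b b→c c→a rewrite loopless a | loopless b | loopless c | a→b | b→c | c→a
                                    | converse-arc (a≢b ∘ sym) a→b | converse-arc (b≢c ∘ sym) b→c
                                    | converse-arc a≢c c→a = refl

2d+1≡3+4k⇒d≡1+2k : ∀ d k → 2 * d + 1 ≡ 3 + 4 * k → d ≡ suc (2 * k)
2d+1≡3+4k⇒d≡1+2k d k 2d+1≡3+4k =
  *-cancelˡ-≡ d (suc (2 * k)) 2 (+-cancelˡ-≡ 1 _ _ (trans (trans (+-comm 1 (2 * d)) 2d+1≡3+4k) (rearrange k)))
  where
  rearrange : ∀ k → 3 + 4 * k ≡ 1 + 2 * suc (2 * k)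
  rearrange = solve-∀

4c+3≡3+4k⇒c≡k : ∀ c k → 4 * c + 3 ≡ 3 + 4 * k → c ≡ k
4c+3≡3+4k⇒c≡k c k 4c+3≡3+4k = *-cancelˡ-≡ c k 4 (+-cancelˡ-≡ 3 _ _ (trans (+-comm 3 (4 * c)) 4c+3≡3+4k))

1+2k≡k+1+k : ∀ k → suc (2 * k) ≡ k + suc k
1+2k≡k+1+k = solve-∀

k+k≡2k : ∀ k → k + k ≡ 2 * k
k+k≡2k k = cong (k +_) (sym (+-identityʳ k))

block-size : ∀ k → (3 + 4 * k ∸ 1) / 2 ≡ suc (2 * k)
block-size k = trans (cong (_/ 2) (rearrange k)) (m*n/n≡m (suc (2 * k)) 2)
  where
  rearrange : ∀ k → 2 + 4 * k ≡ suc (2 * k) * 2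
  rearrange = solve-∀

pair-index : ∀ k → (3 + 4 * k ∸ 3) / 2 ≡ 2 * k
pair-index k = trans (cong (_/ 2) (rearrange k)) (m*n/n≡m (2 * k) 2)
  where
  rearrange : ∀ k → 4 * k ≡ 2 * k * 2
  rearrange = solve-∀

triple-index : ∀ m → (3 + 4 * suc m ∸ 7) / 4 ≡ m
triple-index m = trans (cong (λ x → (x ∸ 7) / 4) (rearrange m)) (trans (cong (_/ 4) (m+n∸m≡n 7 (m * 4))) (m*n/n≡m m 4))
  where
  rearrange : ∀ m → 3 + 4 * suc m ≡ 7 + m * 4
  rearrange = solve-∀

triple-balance : ∀ k N e → 2 * k + 2 * k + 2 * k + 3 ≡ 3 + 4 * k + (2 * N + e) → e + 2 * N ≡ 2 * k
triple-balance k N e balance =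
  +-cancelˡ-≡ (3 + 4 * k) _ _ (trans (rearrange₁ k N e) (trans (sym balance) (rearrange₂ k)))
  where
  rearrange₁ : ∀ k N e → 3 + 4 * k + (e + 2 * N) ≡ 3 + 4 * k + (2 * N + e)
  rearrange₁ = solve-∀
  rearrange₂ : ∀ k → 2 * k + 2 * k + 2 * k + 3 ≡ 3 + 4 * k + 2 * k
  rearrange₂ = solve-∀

order-from-common : ∀ c n → 4 * c + 3 ≡ n → 7 < n → ∃[ m ] n ≡ 3 + 4 * suc (suc m)
order-from-common zero          _ refl (s≤s (s≤s (s≤s ())))
order-from-common (suc zero)    _ refl (s≤s (s≤s (s≤s (s≤s (s≤s (s≤s (s≤s ())))))))
order-from-common (suc (suc m)) _ refl _ = m , +-comm (4 * suc (suc m)) 3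

-- Doubly regular tournaments of order 3 + 4k

module DoublyRegular {k : ℕ} {A : Matrix01 (3 + 4 * k)} (tournament : IsTournament A)
  (out-regular : ∀ x → 2 * ∣ rowSupport A x ∣ + 1 ≡ 3 + 4 * k)
  (in-regular : ∀ x → 2 * ∣ colSupport A x ∣ + 1 ≡ 3 + 4 * k)
  (common-out-regular : ∀ x y → x ≢ y → 4 * ∣ rowSupport A x ∩ rowSupport A y ∣ + 3 ≡ 3 + 4 * k)
  (common-in-regular : ∀ x y → x ≢ y → 4 * ∣ colSupport A x ∩ colSupport A y ∣ + 3 ≡ 3 + 4 * k) where

  open Tournament tournament
  open ≡-Reasoning

  designBlocks : List (Subset (3 + 4 * k))
  designBlocks = blocks A ++ blocks (complementTournament A)

  block-sizes : All (λ B → ∣ B ∣ ≡ suc (2 * k)) designBlocks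
  block-sizes = ++⁺ (map⁺ (All.universal out-size (allFin _))) (map⁺ (All.universal in-size (allFin _)))
    where
    out-size : ∀ x → ∣ rowSupport A x ∣ ≡ suc (2 * k)
    out-size x = 2d+1≡3+4k⇒d≡1+2k _ k (out-regular x)
    in-size : ∀ x → ∣ rowSupport (complementTournament A) x ∣ ≡ suc (2 * k)
    in-size x = trans (cong ∣_∣ (tabulate-cong (complement≡transpose x))) (2d+1≡3+4k⇒d≡1+2k _ k (in-regular x))

  out-degree : ∀ x → count (A x) ≡ suc (2 * k)
  out-degree x = 2d+1≡3+4k⇒d≡1+2k _ k (trans (cong (λ d → 2 * d + 1) (sym (∣tabulate∣≡count (A x)))) (out-regular x))

  common-out : ∀ {x y} → x ≢ y → count (λ z → A x z ∧ A y z) ≡ k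
  common-out {x} {y} x≢y = 4c+3≡3+4k⇒c≡k _ k
    (trans (cong (λ c → 4 * c + 3) (sym (∣tabulate∩tabulate∣≡count (A x) (A y)))) (common-out-regular x y x≢y))

  common-in : ∀ {x y} → x ≢ y → count (λ z → A z x ∧ A z y) ≡ k
  common-in {x} {y} x≢y = 4c+3≡3+4k⇒c≡k _ k
    (trans (cong (λ c → 4 * c + 3) (sym (∣tabulate∩tabulate∣≡count (λ z → A z x) (λ z → A z y))))
           (common-in-regular x y x≢y))

  private-out : ∀ {x y} → x ≢ y → count (λ z → A x z ∧ not (A y z)) ≡ suc k
  private-out {x} {y} x≢y = +-cancelˡ-≡ k _ _ (begin
    k + count (λ z → A x z ∧ not (A y z))
      ≡⟨ cong (_+ count (λ z → A x z ∧ not (A y z))) (common-out x≢y) ⟨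
    count (λ z → A x z ∧ A y z) + count (λ z → A x z ∧ not (A y z))
      ≡⟨ count-∧-split (A x) (A y) ⟨
    count (A x)
      ≡⟨ out-degree x ⟩
    suc (2 * k)
      ≡⟨ 1+2k≡k+1+k k ⟩
    k + suc k ∎)

  pair-hits : ∀ {u v} → u ≢ v → sum (hits (u ∷ v ∷ [])) ≡ 2 * k
  pair-hits {u} {v} u≢v = begin
    sum (hits (u ∷ v ∷ []))
      ≡⟨ ∑-distrib-+ (λ z → indicator (A z u ∧ (A z v ∧ true))) (λ z → indicator (A u z ∧ (A v z ∧ true))) ⟩
    count (λ z → A z u ∧ (A z v ∧ true)) + count (λ z → A u z ∧ (A v z ∧ true))
      ≡⟨ cong₂ _+_ (sum-cong-≗ λ z → cong (λ b → indicator (A z u ∧ b)) (∧-identityʳ (A z v)))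
                   (sum-cong-≗ λ z → cong (λ b → indicator (A u z ∧ b)) (∧-identityʳ (A v z))) ⟩
    count (λ z → A z u ∧ A z v) + count (λ z → A u z ∧ A v z)
      ≡⟨ cong₂ _+_ (common-in u≢v) (common-out u≢v) ⟩
    k + k
      ≡⟨ k+k≡2k k ⟩
    2 * k ∎

  pair-occurrences : ∀ T → ∣ T ∣ ≡ 2 → occurrences T designBlocks ≡ 2 * k
  pair-occurrences T ∣T∣≡2 = from-elements (two-elements ∣T∣≡2)
    where
    from-elements : ∃[ u ] ∃[ v ] u ≢ v × T ≡ fromList (u ∷ v ∷ []) → occurrences T designBlocks ≡ 2 * k
    from-elements (u , v , u≢v , T≡uv) = begin
      occurrences T designBlocks                       ≡⟨ cong (λ S → occurrences S designBlocks) T≡uv ⟩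
      occurrences (fromList (u ∷ v ∷ [])) designBlocks ≡⟨ occurrences≡∑hits (u ∷ v ∷ []) ⟩
      sum (hits (u ∷ v ∷ []))                          ≡⟨ pair-hits u≢v ⟩
      2 * k                                            ∎

  module _ {a b c : Fin (3 + 4 * k)} (a≢b : a ≢ b) (a≢c : a ≢ c) (b≢c : b ≢ c) where

    open Triple a≢b a≢c b≢c

    triple-size : ∣ fromList triple ∣ ≡ 3
    triple-size = ∣fromList∣≡length triple-unique

    hits-balance : apexes + 2 * sum (hits triple) ≡ 2 * k
    hits-balance = triple-balance k (sum (hits triple)) apexes (begin
      2 * k + 2 * k + 2 * k + 3                    ≡⟨ cong (_+ 3) sum-pairHits ⟨
      sum pairHits + 3                             ≡⟨ double-counting ⟩
      3 + 4 * k + (2 * sum (hits triple) + apexes) ∎)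
      where
      sum-pairHits : sum pairHits ≡ 2 * k + 2 * k + 2 * k
      sum-pairHits = begin
        sum pairHits
          ≡⟨ ∑-distrib-+ (λ x → hits (a ∷ b ∷ []) x + hits (a ∷ c ∷ []) x) (hits (b ∷ c ∷ [])) ⟩
        sum (λ x → hits (a ∷ b ∷ []) x + hits (a ∷ c ∷ []) x) + sum (hits (b ∷ c ∷ []))
          ≡⟨ cong (_+ sum (hits (b ∷ c ∷ []))) (∑-distrib-+ (hits (a ∷ b ∷ [])) (hits (a ∷ c ∷ []))) ⟩
        sum (hits (a ∷ b ∷ [])) + sum (hits (a ∷ c ∷ [])) + sum (hits (b ∷ c ∷ []))
          ≡⟨ cong₂ _+_ (cong₂ _+_ (pair-hits a≢b) (pair-hits a≢c)) (pair-hits b≢c) ⟩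
        2 * k + 2 * k + 2 * k ∎

    occurrences-if-apexes-0 : apexes ≡ 0 → occurrences (fromList triple) designBlocks ≡ k
    occurrences-if-apexes-0 apexes≡0 = trans (occurrences≡∑hits triple)
      (*-cancelˡ-≡ _ k 2 (trans (cong (_+ 2 * sum (hits triple)) (sym apexes≡0)) hits-balance))

    occurrences-if-apexes-2 : apexes ≡ 2 → suc (occurrences (fromList triple) designBlocks) ≡ k
    occurrences-if-apexes-2 apexes≡2 = trans (cong suc (occurrences≡∑hits triple)) (*-cancelˡ-≡ _ k 2
      (trans (*-suc 2 (sum (hits triple))) (trans (cong (_+ 2 * sum (hits triple)) (sym apexes≡2)) hits-balance)))

  triple-occurrences : ∀ T → ∣ T ∣ ≡ 3 → occurrences T designBlocks ≡ k ⊎ suc (occurrences T designBlocks) ≡ k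
  triple-occurrences T ∣T∣≡3 = from-elements (three-elements ∣T∣≡3)
    where
    from-elements : ∃[ a ] ∃[ b ] ∃[ c ] a ≢ b × a ≢ c × b ≢ c × T ≡ fromList (a ∷ b ∷ c ∷ []) →
      occurrences T designBlocks ≡ k ⊎ suc (occurrences T designBlocks) ≡ k
    from-elements (a , b , c , a≢b , a≢c , b≢c , refl) =
      Sum.map (occurrences-if-apexes-0 a≢b a≢c b≢c) (occurrences-if-apexes-2 a≢b a≢c b≢c)
              (Triple.apexes-0-or-2 a≢b a≢c b≢c)

  -- For an arc 0 → b, a common out-neighbour c of 0 and b gives a transitive triple and an
  -- out-neighbour d of b that is not an out-neighbour of 0 gives the cyclic triple 0 → b → d → 0.
  not-3-design : ∀ {m s μ} → k ≡ suc m → ¬ IsDesign 3 (3 + 4 * k) s μ designBlocks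
  not-3-design {μ = μ} k≡1+m (_ , through) with count≡1+m⇒∃ (out-degree zero)
  ... | b , 0→b with count≡1+m⇒∃ (trans (common-out (arc⇒≢ 0→b)) k≡1+m) | count≡1+m⇒∃ (private-out (arc⇒≢ 0→b ∘ sym))
  ... | c , 0→c∧b→c | d , b→d∧0↛d with ∧≡true⇒ 0→c∧b→c | ∧≡true⇒ b→d∧0↛d
  ... | 0→c , b→c | b→d , 0↛d = 1+n≢n (trans transitive-count (sym cyclic-count))
    where
    0≢b : zero ≢ b
    0≢b = arc⇒≢ 0→b
    0≢c : zero ≢ c
    0≢c = arc⇒≢ 0→c
    b≢c : b ≢ c
    b≢c = arc⇒≢ b→c
    b≢d : b ≢ d
    b≢d = arc⇒≢ b→d
    0≢d : zero ≢ d
    0≢d refl = contradiction (trans (sym b→d) (converse-arc (0≢b ∘ sym) 0→b)) λ ()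
    d→0 : A d zero ≡ true
    d→0 = trans (antisymmetric 0≢d) (cong not (not-injective 0↛d))
    transitive-count : suc μ ≡ k
    transitive-count = trans (cong suc (sym (through (fromList (zero ∷ b ∷ c ∷ [])) (triple-size 0≢b 0≢c b≢c))))
      (occurrences-if-apexes-2 0≢b 0≢c b≢c (Triple.apexes-transitive 0≢b 0≢c b≢c 0→b 0→c))
    cyclic-count : μ ≡ k
    cyclic-count = trans (sym (through (fromList (zero ∷ b ∷ d ∷ [])) (triple-size 0≢b 0≢d b≢d)))
      (occurrences-if-apexes-0 0≢b 0≢d b≢d (Triple.apexes-cyclic 0≢b 0≢d b≢d 0→b b→d d→0))

order-parameter : {A : Matrix01 n} → IsDoublyRegularTournament A → 7 < n → ∃[ m ] n ≡ 3 + 4 * suc (suc m)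
order-parameter {zero}        _ ()
order-parameter {suc zero}    _ (s≤s ())
order-parameter {suc (suc n)} {A} (_ , _ , _ , common-out-regular , _) 7<n =
  order-from-common ∣ rowSupport A zero ∩ rowSupport A (suc zero) ∣ _ (common-out-regular zero (suc zero) λ ()) 7<n

doubly-regular-designs : {A : Matrix01 n} → IsDoublyRegularTournament A → ∃[ m ] n ≡ 3 + 4 * suc (suc m) →
  IsDesign 2 n ((n ∸ 1) / 2) ((n ∸ 3) / 2) (blocks A ++ blocks (complementTournament A)) ×
  IsADesign 3 n ((n ∸ 1) / 2) ((n ∸ 7) / 4) (blocks A ++ blocks (complementTournament A))
doubly-regular-designs (tournament , out-regular , in-regular , common-out-regular , common-in-regular) (m , refl) =
  (sizes , pairs) , (λ>0 , sizes , triples , λ (_ , design) → not-3-design refl design)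
  where
  open DoublyRegular {suc (suc m)} tournament out-regular in-regular common-out-regular common-in-regular
  k : ℕ
  k = suc (suc m)
  sizes : All (λ B → ∣ B ∣ ≡ (3 + 4 * k ∸ 1) / 2) designBlocks
  sizes = subst (λ s → All (λ B → ∣ B ∣ ≡ s) designBlocks) (sym (block-size k)) block-sizes
  pairs : ∀ T → ∣ T ∣ ≡ 2 → occurrences T designBlocks ≡ (3 + 4 * k ∸ 3) / 2
  pairs T ∣T∣≡2 = trans (pair-occurrences T ∣T∣≡2) (sym (pair-index k))
  λ>0 : 0 < (3 + 4 * k ∸ 7) / 4
  λ>0 = subst (0 <_) (sym (triple-index (suc m))) (s≤s z≤n)
  triples : ∀ T → ∣ T ∣ ≡ 3 →
    occurrences T designBlocks ≡ (3 + 4 * k ∸ 7) / 4 ⊎ occurrences T designBlocks ≡ suc ((3 + 4 * k ∸ 7) / 4)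
  triples T ∣T∣≡3 rewrite triple-index (suc m) = Sum.swap (Sum.map₂ suc-injective (triple-occurrences T ∣T∣≡3))

theorem2 : (n : ℕ) (A : Matrix01 n) →
    IsDoublyRegularTournament A →
    7 < n →
    IsDesign 2 n ((n ∸ 1) / 2) ((n ∸ 3) / 2) (blocks A ++ blocks (complementTournament A)) ×
    IsADesign 3 n ((n ∸ 1) / 2) ((n ∸ 7) / 4) (blocks A ++ blocks (complementTournament A))
theorem2 n A drt 7<n = doubly-regular-designs drt (order-parameter drt 7<n)
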